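{- Let $\mathtt{UnaryOp}$ be a finite set of unary operations on $\mathbb N$. There is no RAM with operation set $\mathtt{UnaryOp}$ such that, for any input integer $N$: (1) (pre-computation) the RAM computes some tables in space $O(N)$; (2) (addition) by using these pre-computed tables and by reading any two integers $x,y<N$, the RAM computes in constant time their sum $x+y$. Moreover, this remains true if the RAM is also allowed to use any (in)equality test among $=,\ne,<,\le$ (and $>,\ge$) between registers in its branching instructions.
   Context: RAM with operation set $\mathtt{Op}$: registers holding natural numbers: accumulator $A$, buffer $B$, work registers $R[0],R[1],\dots$ (initially $0$), input size register $N$. Instructions: $\mathtt{CST}\ j$ ($A\gets j$ for a fixed integer $j$), $\mathtt{Buffer}$ ($B\gets A$), $\mathtt{Store}$ ($R[A]\gets B$), $\mathtt{Load}$ ($A\gets R[A]$), $\mathtt{Jzero}\ \ell_0\ \ell_1$ (jump to instruction $\ell_0$ if $A=0$, else to $\ell_1$), $\mathtt{getN}$ ($A\gets N$), $\mathtt{Output}$, and $A\gets\mathtt{op}(A)$ for $\mathtt{op}\in\mathtt{Op}$. Each instruction costs one time unit; register contents and addresses are $O(N)$. "Constant time" means a number of instructions bounded independently of $N$, $x$, $y$. -}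

module Defs where

open import Data.Nat using (ℕ; zero; suc; _+_; _*_; _≤_; _<_; _≡ᵇ_; _<ᵇ_; _≤ᵇ_)
open import Data.Bool using (Bool; true; false; if_then_else_; not; T)
open import Data.Fin using (Fin)
open import Data.List using (List; []; _∷_)
open import Data.Maybe using (Maybe; just; nothing)
open import Data.Product using (Σ; ∃; _×_)
open import Relation.Binary.PropositionalEquality using (_≡_)

data CmpRel : Set where
  eq neq lt le gt ge : CmpRel

holds : CmpRel → ℕ → ℕ → Bool
holds eq  a b = a ≡ᵇ b
holds neq a b = not (a ≡ᵇ b)
holds lt  a b = a <ᵇ b
holds le  a b = a ≤ᵇ b
holds gt  a b = b <ᵇ a
holds ge  a b = b ≤ᵇ a

-- The flag `cmp` says whether comparison branching instructions are
-- allowed (Jcmp needs a proof of T cmp).  Labels are instruction indices.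

data Instr (k : ℕ) (cmp : Bool) : Set where
  CST    : ℕ → Instr k cmp
  Buffer : Instr k cmp
  Store  : Instr k cmp
  Load   : Instr k cmp
  Jzero  : ℕ → ℕ → Instr k cmp
  getN   : Instr k cmp
  Output : Instr k cmp
  Op     : Fin k → Instr k cmp
  Jcmp   : T cmp → CmpRel → ℕ → ℕ → Instr k cmp

Program : ℕ → Bool → Set
Program k cmp = List (Instr k cmp)

fetch : {X : Set} → List X → ℕ → Maybe X
fetch []       _       = nothing
fetch (x ∷ xs) zero    = just x
fetch (x ∷ xs) (suc n) = fetch xs n

record State : Set where
  constructor ⟨_,_,_,_⟩
  field
    pc : ℕ
    A  : ℕ
    B  : ℕ
    R  : ℕ → ℕ
open State public

data Step : Set where
  next  : State → Step
  halt  : State → Step   -- Output executed in this state (output = A)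
  crash : Step

update : (ℕ → ℕ) → ℕ → ℕ → (ℕ → ℕ)
update r a v i = if i ≡ᵇ a then v else r i

exec : ∀ {k cmp} → (Fin k → ℕ → ℕ) → ℕ → Instr k cmp → State → Step
exec ops N (CST j)          ⟨ p , a , b , r ⟩ = next ⟨ suc p , j , b , r ⟩
exec ops N Buffer           ⟨ p , a , b , r ⟩ = next ⟨ suc p , a , a , r ⟩
exec ops N Store            ⟨ p , a , b , r ⟩ = next ⟨ suc p , a , b , update r a b ⟩
exec ops N Load             ⟨ p , a , b , r ⟩ = next ⟨ suc p , r a , b , r ⟩
exec ops N (Jzero l₀ l₁)    ⟨ p , a , b , r ⟩ =
  next ⟨ (if a ≡ᵇ 0 then l₀ else l₁) , a , b , r ⟩
exec ops N getN             ⟨ p , a , b , r ⟩ = next ⟨ suc p , N , b , r ⟩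
exec ops N Output           s                 = halt s
exec ops N (Op i)           ⟨ p , a , b , r ⟩ = next ⟨ suc p , ops i a , b , r ⟩
exec ops N (Jcmp _ ρ l₀ l₁) ⟨ p , a , b , r ⟩ =
  next ⟨ (if holds ρ a b then l₀ else l₁) , a , b , r ⟩

step : ∀ {k cmp} → (Fin k → ℕ → ℕ) → ℕ → Program k cmp → State → Step
step ops N P s with fetch P (pc s)
... | nothing = crash
... | just ι  = exec ops N ι s

run : ∀ {k cmp} → (Fin k → ℕ → ℕ) → ℕ → Program k cmp → ℕ → State → Step
run ops N P zero    s = next s
run ops N P (suc t) s with step ops N P s
... | next s' = run ops N P t s'
... | halt s' = halt s'
... | crash   = crash

-- all register contents (hence all addresses, which are values of A) ≤ b
Bounded : ℕ → State → Set
Bounded b s = A s ≤ b × B s ≤ b × (∀ i → R s i ≤ b)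

SpaceBounded : ∀ {k cmp} → (Fin k → ℕ → ℕ) → ℕ → Program k cmp → ℕ → State → Set
SpaceBounded ops N P b s = ∀ t s' → run ops N P t s ≡ next s' → Bounded b s'

initial : State
initial = ⟨ 0 , 0 , 0 , (λ _ → 0) ⟩

record RAM (k : ℕ) (cmp : Bool) : Set where
  field
    pre : Program k cmp
    add : Program k cmp
open RAM public

-- On input N, with space constant c and time constant τ:
--  * pre, started from the all-zero configuration, halts (Output) in some
--    configuration sf, with all contents/addresses ≤ c·(N+1) throughout;
--  * for all x, y < N, add, started with A = x, B = y, pc = 0 and the memory
--    R of sf (the tables), keeps all contents/addresses ≤ c·(N+1) and
--    executes Output within τ steps with A = x + y.
ComputesSum : ∀ {k cmp} → (Fin k → ℕ → ℕ) → RAM k cmp → ℕ → ℕ → ℕ → Set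
ComputesSum ops M c τ N =
  Σ State λ sf →
    (∃ λ t → run ops N (pre M) t initial ≡ halt sf)
    × SpaceBounded ops N (pre M) (c * suc N) initial
    × (∀ x y → x < N → y < N →
         SpaceBounded ops N (add M) (c * suc N) ⟨ 0 , x , y , R sf ⟩
         × Σ ℕ λ t → t ≤ τ × Σ State λ sh →
             run ops N (add M) t ⟨ 0 , x , y , R sf ⟩ ≡ halt sh × A sh ≡ x + y)

-- Run the addition program on inputs (x, y) with tables T and tag every register and every
-- stored value with its provenance: a function of x alone, of y alone, or of neither. Unary
-- operations and lookups in T preserve such a tag, and x and y only meet in comparisons, which
-- merely choose the control path. The trace of a run records every branch outcome and, for each
-- Load, which store of the run (if any) it reads from; two runs with the same trace follow the
-- same path, so their outputs carry the same tag and coincide when the inputs agree on that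
-- source. Within τ steps there are fewer than K = (τ+2)^τ traces, so pigeonholing first along the
-- rows, then across the rows of a grid of height 1 + K(K+1) and width K + 1 gives x ≠ x′, y ≠ y′
-- with equal traces at (x, y), (x, y′) and (x′, y). An output tagged by x or constant forces
-- x + y = x + y′, one tagged by y forces x + y = x′ + y. Neither the space bound nor how the
-- tables were computed plays any role.

module Submission where

open import Defs
open import Data.Bool using (Bool; true; false; if_then_else_)
open import Data.Empty using (⊥)
open import Data.Fin using (Fin; toℕ; fromℕ<)
open import Data.Fin.Properties using (pigeonhole; toℕ<n; toℕ-fromℕ<)
open import Data.List using (List; []; _∷_; length)
open import Data.List.Properties using (∷-injectiveˡ; ∷-injectiveʳ)
open import Data.List.Relation.Unary.All as All using (All; []; _∷_)
open import Data.List.Relation.Binary.Pointwise using (Pointwise; []; _∷_)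
open import Data.List.Relation.Binary.Pointwise.Properties using (Pointwise-length)
open import Data.Maybe using (just; nothing)
open import Data.Nat
open import Data.Nat.DivMod using (_%_; [m+kn]%n≡m%n; m<n⇒m%n≡m)
open import Data.Nat.Properties
open import Data.Product using (Σ; ∃; _×_; _,_; proj₁; proj₂)
open import Data.Unit using (⊤; tt)
open import Function using (id)
open import Relation.Binary.PropositionalEquality
open import Relation.Nullary using (¬_; contradiction)

+-*-< : ∀ {r d c m} → d < r → c < m → d + c * r < m * r
+-*-< {r} {d} {c} d<r c<m = <-≤-trans (+-monoˡ-< (c * r) d<r) (*-monoˡ-≤ r c<m)

+-*-injective : ∀ {r d₁ d₂ c₁ c₂} → d₁ < r → d₂ < r →
                d₁ + c₁ * r ≡ d₂ + c₂ * r → d₁ ≡ d₂ × c₁ ≡ c₂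
+-*-injective {r} {d₁} {d₂} {c₁} {c₂} d₁<r d₂<r same = d₁≡d₂ , c₁≡c₂
  where
  instance _ = >-nonZero (≤-<-trans z≤n d₁<r)
  d₁≡d₂ : d₁ ≡ d₂
  d₁≡d₂ = begin
    d₁                 ≡⟨ m<n⇒m%n≡m d₁<r ⟨
    d₁ % r             ≡⟨ [m+kn]%n≡m%n d₁ c₁ r ⟨
    (d₁ + c₁ * r) % r  ≡⟨ cong (_% r) same ⟩
    (d₂ + c₂ * r) % r  ≡⟨ [m+kn]%n≡m%n d₂ c₂ r ⟩
    d₂ % r             ≡⟨ m<n⇒m%n≡m d₂<r ⟩
    d₂                 ∎
    where open ≡-Reasoning
  c₁≡c₂ : c₁ ≡ c₂
  c₁≡c₂ = *-cancelʳ-≡ c₁ c₂ r (+-cancelˡ-≡ d₁ _ _ (trans same (cong (_+ c₂ * r) (sym d₁≡d₂))))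

encode : ℕ → List ℕ → ℕ
encode r []       = 0
encode r (d ∷ ds) = suc d + encode r ds * r

encode-< : ∀ {r} ds → All (λ d → suc d < r) ds → encode r ds < r ^ length ds
encode-< {r} []       []          = z<s
encode-< {r} (d ∷ ds) (d<r ∷ ds<r) = subst (encode r (d ∷ ds) <_) (*-comm (r ^ length ds) r) (+-*-< d<r (encode-< ds ds<r))

encode-injective : ∀ {r} ds₁ ds₂ → All (λ d → suc d < r) ds₁ → All (λ d → suc d < r) ds₂ →
                   encode r ds₁ ≡ encode r ds₂ → ds₁ ≡ ds₂
encode-injective []         []         _            _            _  = refl
encode-injective (d₁ ∷ ds₁) (d₂ ∷ ds₂) (d₁<r ∷ ds₁<r) (d₂<r ∷ ds₂<r) same
  with refl , c ← +-*-injective d₁<r d₂<r same = cong (d₁ ∷_) (encode-injective ds₁ ds₂ ds₁<r ds₂<r c)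

record Collision (f : ℕ → ℕ) (n : ℕ) : Set where
  field
    i j     : ℕ
    i<j     : i < j
    j<n     : j < n
    f-i≡f-j : f i ≡ f j

ℕ-pigeonhole : ∀ {m n} → m < n → (f : ℕ → ℕ) → (∀ i → f i < m) → Collision f n
ℕ-pigeonhole m<n f f<m with i , j , i<j , fi≡fj ← pigeonhole m<n (λ i → fromℕ< (f<m (toℕ i))) =
  record { i = toℕ i ; j = toℕ j ; i<j = i<j ; j<n = toℕ<n j
         ; f-i≡f-j = trans (sym (toℕ-fromℕ< (f<m (toℕ i))))
                           (trans (cong toℕ fi≡fj) (toℕ-fromℕ< (f<m (toℕ j)))) }

record LShape (key : ℕ → ℕ → ℕ) (m n : ℕ) : Set where
  field
    x x′ y y′  : ℕ
    x<m        : x < m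
    x′<m       : x′ < m
    y<n        : y < n
    y′<n       : y′ < n
    x≢x′       : x ≢ x′
    y≢y′       : y ≢ y′
    key-row    : key x y ≡ key x y′
    key-column : key x y ≡ key x′ y

l-shape : ∀ K (key : ℕ → ℕ → ℕ) → (∀ x y → key x y < K) → LShape key (suc (K * suc K)) (suc K)
l-shape K key key<K = record
  { x = x ; x′ = x′ ; y = Row.i x ; y′ = Row.j x
  ; x<m = <-trans i<j j<n ; x′<m = j<n ; y<n = y<n x ; y′<n = Row.j<n x
  ; x≢x′ = <⇒≢ i<j ; y≢y′ = <⇒≢ (Row.i<j x)
  ; key-row = Row.f-i≡f-j x
  ; key-column = trans same-key (cong (key x′) (sym same-y))
  }
  where
  module Row x = Collision (ℕ-pigeonhole ≤-refl (key x) (key<K x))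
  y<n : ∀ x → Row.i x < suc K
  y<n x = <-trans (Row.i<j x) (Row.j<n x)
  pair : ℕ → ℕ
  pair x = key x (Row.i x) + Row.i x * K
  pair< : ∀ x → pair x < K * suc K
  pair< x = subst (pair x <_) (*-comm (suc K) K) (+-*-< (key<K x (Row.i x)) (y<n x))
  open Collision (ℕ-pigeonhole ≤-refl pair pair<) renaming (i to x; j to x′)
  same-key×same-y : key x (Row.i x) ≡ key x′ (Row.i x′) × Row.i x ≡ Row.i x′
  same-key×same-y = +-*-injective (key<K x (Row.i x)) (key<K x′ (Row.i x′)) f-i≡f-j
  same-key : key x (Row.i x) ≡ key x′ (Row.i x′)
  same-key = proj₁ same-key×same-y
  same-y : Row.i x ≡ Row.i x′
  same-y = proj₂ same-key×same-y

data Tag : Set where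
  fromX fromY constant : Tag

record Entry : Set where
  constructor entry
  field
    address : ℕ
    tag     : Tag
    value   : ℕ
open Entry

record Annotation : Set where
  constructor annotation
  field
    tagA tagB : Tag
    log       : List Entry
open Annotation

memory : (ℕ → ℕ) → List Entry → ℕ → ℕ
memory table []      = table
memory table (e ∷ l) = update (memory table l) (address e) (value e)

-- 0 if a has not been stored to during the run, otherwise one more than the position,
-- counted from the first store, of the latest store to a.
storeStamp : List Entry → ℕ → ℕ
storeStamp []      a = 0
storeStamp (e ∷ l) a = if a ≡ᵇ address e then suc (length l) else storeStamp l a

loadTag : Tag → List Entry → ℕ → Tag
loadTag t []      a = t
loadTag t (e ∷ l) a = if a ≡ᵇ address e then tag e else loadTag t l a

branch : Bool → ℕ
branch true  = 0
branch false = 1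

annotate : ∀ {k cmp} → Instr k cmp → State → Annotation → Annotation × ℕ
annotate (CST _)        s (annotation tA tB l) = annotation constant tB l , 0
annotate Buffer         s (annotation tA tB l) = annotation tA tA l , 0
annotate Store          s (annotation tA tB l) = annotation tA tB (entry (A s) tB (B s) ∷ l) , 0
annotate Load           s (annotation tA tB l) = annotation (loadTag tA l (A s)) tB l , storeStamp l (A s)
annotate (Jzero _ _)    s a                    = a , branch (A s ≡ᵇ 0)
annotate getN           s (annotation tA tB l) = annotation constant tB l , 0
annotate Output         s a                    = a , 0
annotate (Op _)         s a                    = a , 0
annotate (Jcmp _ ρ _ _) s a                    = a , branch (holds ρ (A s) (B s))

storeStamp-≤ : ∀ l a → storeStamp l a ≤ length l
storeStamp-≤ []      a = z≤n
storeStamp-≤ (e ∷ l) a with a ≡ᵇ address e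
... | true  = ≤-refl
... | false = m≤n⇒m≤1+n (storeStamp-≤ l a)

fresh-stamp : ∀ {n} l → length l ≡ n → ∀ a → storeStamp l a ≢ suc n
fresh-stamp {n} l length≡n a stamp≡ = 1+n≰n (begin
  suc n            ≡⟨ stamp≡ ⟨
  storeStamp l a   ≤⟨ storeStamp-≤ l a ⟩
  length l         ≡⟨ length≡n ⟩
  n                ∎)
  where open ≤-Reasoning

branch-≤ : ∀ b → branch b ≤ 1
branch-≤ true  = z≤n
branch-≤ false = ≤-refl

annotate-digit-≤ : ∀ {k cmp} (ι : Instr k cmp) s a → proj₂ (annotate ι s a) ≤ suc (length (log a))
annotate-digit-≤ (CST _)        s a = z≤n
annotate-digit-≤ Buffer         s a = z≤n
annotate-digit-≤ Store          s a = z≤n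
annotate-digit-≤ Load           s a = m≤n⇒m≤1+n (storeStamp-≤ (log a) (A s))
annotate-digit-≤ (Jzero _ _)    s a = ≤-trans (branch-≤ _) (s≤s z≤n)
annotate-digit-≤ getN           s a = z≤n
annotate-digit-≤ Output         s a = z≤n
annotate-digit-≤ (Op _)         s a = z≤n
annotate-digit-≤ (Jcmp _ ρ _ _) s a = ≤-trans (branch-≤ _) (s≤s z≤n)

annotate-log-≤ : ∀ {k cmp} (ι : Instr k cmp) s a → length (log (proj₁ (annotate ι s a))) ≤ suc (length (log a))
annotate-log-≤ (CST _)        s a = n≤1+n _
annotate-log-≤ Buffer         s a = n≤1+n _
annotate-log-≤ Store          s a = ≤-refl
annotate-log-≤ Load           s a = n≤1+n _
annotate-log-≤ (Jzero _ _)    s a = n≤1+n _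
annotate-log-≤ getN           s a = n≤1+n _
annotate-log-≤ Output         s a = n≤1+n _
annotate-log-≤ (Op _)         s a = n≤1+n _
annotate-log-≤ (Jcmp _ ρ _ _) s a = n≤1+n _

record Outcome : Set where
  constructor outcome
  field
    final           : Step
    finalAnnotation : Annotation
    trace           : List ℕ
open Outcome

_◂_ : ℕ → Outcome → Outcome
d ◂ outcome f a ds = outcome f a (d ∷ ds)

run-halt-≤ : ∀ {k cmp} (ops : Fin k → ℕ → ℕ) N (P : Program k cmp) {t t′ s h} →
             t ≤ t′ → run ops N P t s ≡ halt h → run ops N P t′ s ≡ halt h
run-halt-≤ ops N P {suc t} {suc t′} {s} (s≤s t≤t′) halts with step ops N P s
... | next s′ = run-halt-≤ ops N P t≤t′ halts
... | halt _  = halts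

update-cong : ∀ {r r′} a v → r ≗ r′ → update r a v ≗ update r′ a v
update-cong a v r≗r′ i = cong (if i ≡ᵇ a then v else_) (r≗r′ i)

module Indistinguishable (Same : Tag → Set) (table : ℕ → ℕ) where

  _∼_ : Tag × ℕ → Tag × ℕ → Set
  (t₁ , v₁) ∼ (t₂ , v₂) = t₁ ≡ t₂ × (Same t₁ → v₁ ≡ v₂)

  map-∼ : ∀ (f : ℕ → ℕ) {t₁ v₁ t₂ v₂} → (t₁ , v₁) ∼ (t₂ , v₂) → (t₁ , f v₁) ∼ (t₂ , f v₂)
  map-∼ f (t₁≡t₂ , agree) = t₁≡t₂ , λ same → cong f (agree same)

  EntryRelated : Entry → Entry → Set
  EntryRelated e₁ e₂ = (tag e₁ , value e₁) ∼ (tag e₂ , value e₂)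

  load-∼ : ∀ {l₁ l₂ t₁ t₂ a₁ a₂} → Pointwise EntryRelated l₁ l₂ → (t₁ , a₁) ∼ (t₂ , a₂) →
           storeStamp l₁ a₁ ≡ storeStamp l₂ a₂ →
           (loadTag t₁ l₁ a₁ , memory table l₁ a₁) ∼ (loadTag t₂ l₂ a₂ , memory table l₂ a₂)
  load-∼ [] address∼ _ = map-∼ table address∼
  load-∼ {e₁ ∷ l₁} {e₂ ∷ l₂} {a₁ = a₁} {a₂} (e₁∼e₂ ∷ logs) address∼ same-stamp
    with a₁ ≡ᵇ address e₁ | a₂ ≡ᵇ address e₂
  ... | true  | true  = e₁∼e₂
  ... | false | false = load-∼ logs address∼ same-stamp
  ... | true  | false = contradiction (sym same-stamp) (fresh-stamp l₂ (sym (Pointwise-length logs)) a₂)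
  ... | false | true  = contradiction same-stamp (fresh-stamp l₁ (Pointwise-length logs) a₁)

  load-related : ∀ {l₁ l₂ r₁ r₂ t₁ t₂ a₁ a₂} → Pointwise EntryRelated l₁ l₂ →
                 r₁ ≗ memory table l₁ → r₂ ≗ memory table l₂ → (t₁ , a₁) ∼ (t₂ , a₂) →
                 storeStamp l₁ a₁ ≡ storeStamp l₂ a₂ → (loadTag t₁ l₁ a₁ , r₁ a₁) ∼ (loadTag t₂ l₂ a₂ , r₂ a₂)
  load-related {a₁ = a₁} {a₂} logs mem₁ mem₂ address∼ same-stamp
    with t₁≡t₂ , agree ← load-∼ logs address∼ same-stamp =
    t₁≡t₂ , λ same → trans (mem₁ a₁) (trans (agree same) (sym (mem₂ a₂)))

  data Related : State → Annotation → State → Annotation → Set where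
    related : ∀ {p a₁ b₁ r₁ a₂ b₂ r₂ tA₁ tB₁ l₁ tA₂ tB₂ l₂} →
              (tA₁ , a₁) ∼ (tA₂ , a₂) → (tB₁ , b₁) ∼ (tB₂ , b₂) → Pointwise EntryRelated l₁ l₂ →
              r₁ ≗ memory table l₁ → r₂ ≗ memory table l₂ →
              Related ⟨ p , a₁ , b₁ , r₁ ⟩ (annotation tA₁ tB₁ l₁) ⟨ p , a₂ , b₂ , r₂ ⟩ (annotation tA₂ tB₂ l₂)

  HaltRelated : Outcome → Outcome → Set
  HaltRelated o₁ o₂ = ∀ {h₁ h₂} → final o₁ ≡ halt h₁ → final o₂ ≡ halt h₂ →
                      (tagA (finalAnnotation o₁) , A h₁) ∼ (tagA (finalAnnotation o₂) , A h₂)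

module AnnotatedRun {k cmp} (ops : Fin k → ℕ → ℕ) (N : ℕ) (P : Program k cmp) where

  arun : ℕ → State → Annotation → Outcome
  arun zero    s a = outcome (next s) a []
  arun (suc t) s a with fetch P (pc s)
  ... | nothing = outcome crash a []
  ... | just ι with exec ops N ι s
  ...   | next s′ = proj₂ (annotate ι s a) ◂ arun t s′ (proj₁ (annotate ι s a))
  ...   | halt h  = outcome (halt h) a []
  ...   | crash   = outcome crash a []

  final-arun : ∀ t s a → final (arun t s a) ≡ run ops N P t s
  final-arun zero    s a = refl
  final-arun (suc t) s a with fetch P (pc s)
  ... | nothing = refl
  ... | just ι with exec ops N ι s
  ...   | next s′ = final-arun t s′ _
  ...   | halt h  = refl
  ...   | crash   = refl

  trace-length-≤ : ∀ t s a → length (trace (arun t s a)) ≤ t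
  trace-length-≤ zero    s a = z≤n
  trace-length-≤ (suc t) s a with fetch P (pc s)
  ... | nothing = z≤n
  ... | just ι with exec ops N ι s
  ...   | next s′ = s≤s (trace-length-≤ t s′ _)
  ...   | halt h  = z≤n
  ...   | crash   = z≤n

  trace-digits-≤ : ∀ t s a → All (_≤ length (log a) + t) (trace (arun t s a))
  trace-digits-≤ zero    s a = []
  trace-digits-≤ (suc t) s a with fetch P (pc s)
  ... | nothing = []
  ... | just ι with exec ops N ι s
  ...   | next s′ = first ∷ All.map (λ d≤ → ≤-trans d≤ rest) (trace-digits-≤ t s′ _)
    where
    n : ℕ
    n = length (log a)
    first : proj₂ (annotate ι s a) ≤ n + suc t
    first = ≤-trans (annotate-digit-≤ ι s a) (≤-trans (s≤s (m≤m+n n t)) (≤-reflexive (sym (+-suc n t))))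
    rest : length (log (proj₁ (annotate ι s a))) + t ≤ n + suc t
    rest = ≤-trans (+-monoˡ-≤ t (annotate-log-≤ ι s a)) (≤-reflexive (sym (+-suc n t)))
  ...   | halt h  = []
  ...   | crash   = []

  module Simulation (Same : Tag → Set) (table : ℕ → ℕ) where
    open Indistinguishable Same table

    mutual
      simulation : ∀ t {s₁ a₁ s₂ a₂} → Related s₁ a₁ s₂ a₂ →
                   trace (arun t s₁ a₁) ≡ trace (arun t s₂ a₂) → HaltRelated (arun t s₁ a₁) (arun t s₂ a₂)
      simulation zero    _ _ = λ ()
      simulation (suc t) (related {p = p} {a₁ = a₁} {b₁ = b₁} {a₂ = a₂} {b₂ = b₂} A∼ B∼ logs mem₁ mem₂) same-trace
        with fetch P p
      ... | nothing            = λ ()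
      ... | just (CST _)       = simulation t (related (refl , λ _ → refl) B∼ logs mem₁ mem₂) (∷-injectiveʳ same-trace)
      ... | just Buffer        = simulation t (related A∼ A∼ logs mem₁ mem₂) (∷-injectiveʳ same-trace)
      ... | just Store         = simulation t (related A∼ B∼ (B∼ ∷ logs) (update-cong a₁ b₁ mem₁) (update-cong a₂ b₂ mem₂))
                                            (∷-injectiveʳ same-trace)
      ... | just Load          = simulation t (related (load-related logs mem₁ mem₂ A∼ (∷-injectiveˡ same-trace))
                                                       B∼ logs mem₁ mem₂)
                                            (∷-injectiveʳ same-trace)
      ... | just (Jzero ℓ₀ ℓ₁) = jump t ℓ₀ ℓ₁ (a₁ ≡ᵇ 0) (a₂ ≡ᵇ 0) (λ _ → related A∼ B∼ logs mem₁ mem₂) same-trace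
      ... | just getN          = simulation t (related (refl , λ _ → refl) B∼ logs mem₁ mem₂) (∷-injectiveʳ same-trace)
      ... | just Output        = λ { refl refl → A∼ }
      ... | just (Op f)        = simulation t (related (map-∼ (ops f) A∼) B∼ logs mem₁ mem₂) (∷-injectiveʳ same-trace)
      ... | just (Jcmp _ ρ ℓ₀ ℓ₁) =
        jump t ℓ₀ ℓ₁ (holds ρ a₁ b₁) (holds ρ a₂ b₂) (λ _ → related A∼ B∼ logs mem₁ mem₂) same-trace

      jump : ∀ t ℓ₀ ℓ₁ c₁ c₂ {a₁ b₁ r₁ a₂ b₂ r₂ n₁ n₂} →
             (∀ p → Related ⟨ p , a₁ , b₁ , r₁ ⟩ n₁ ⟨ p , a₂ , b₂ , r₂ ⟩ n₂) →
             let s₁ = ⟨ (if c₁ then ℓ₀ else ℓ₁) , a₁ , b₁ , r₁ ⟩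
                 s₂ = ⟨ (if c₂ then ℓ₀ else ℓ₁) , a₂ , b₂ , r₂ ⟩ in
             branch c₁ ∷ trace (arun t s₁ n₁) ≡ branch c₂ ∷ trace (arun t s₂ n₂) →
             HaltRelated (branch c₁ ◂ arun t s₁ n₁) (branch c₂ ◂ arun t s₂ n₂)
      jump t ℓ₀ ℓ₁ true  true  rel same-trace = simulation t (rel ℓ₀) (∷-injectiveʳ same-trace)
      jump t ℓ₀ ℓ₁ false false rel same-trace = simulation t (rel ℓ₁) (∷-injectiveʳ same-trace)

input : (ℕ → ℕ) → ℕ → ℕ → State
input table x y = ⟨ 0 , x , y , table ⟩

inputAnnotation : Annotation
inputAnnotation = annotation fromX fromY []

SameSource : ℕ → ℕ → ℕ → ℕ → Tag → Set
SameSource x₁ y₁ x₂ y₂ fromX    = x₁ ≡ x₂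
SameSource x₁ y₁ x₂ y₂ fromY    = y₁ ≡ y₂
SameSource x₁ y₁ x₂ y₂ constant = ⊤

sum-depends-on-both : ∀ {x x′ y y′} t → x ≢ x′ → y ≢ y′ →
                      (SameSource x y x y′ t → x + y ≡ x + y′) →
                      (SameSource x y x′ y t → x + y ≡ x′ + y) → ⊥
sum-depends-on-both {x} {x′} {y} {y′} fromX    _    y≢y′ row _      = y≢y′ (+-cancelˡ-≡ x y y′ (row refl))
sum-depends-on-both {x} {x′} {y} {y′} constant _    y≢y′ row _      = y≢y′ (+-cancelˡ-≡ x y y′ (row tt))
sum-depends-on-both {x} {x′} {y} {y′} fromY    x≢x′ _    _   column = x≢x′ (+-cancelʳ-≡ y x x′ (column refl))

module InputRun {k cmp} (ops : Fin k → ℕ → ℕ) (N : ℕ) (P : Program k cmp) (τ : ℕ) (table : ℕ → ℕ) where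
  open AnnotatedRun ops N P

  outcomeOn : ℕ → ℕ → Outcome
  outcomeOn x y = arun τ (input table x y) inputAnnotation

  finalTag : ℕ → ℕ → Tag
  finalTag x y = tagA (finalAnnotation (outcomeOn x y))

  key : ℕ → ℕ → ℕ
  key x y = encode (2 + τ) (trace (outcomeOn x y))

  digits-< : ∀ x y → All (λ d → suc d < 2 + τ) (trace (outcomeOn x y))
  digits-< x y = All.map (λ d≤τ → s≤s (s≤s d≤τ)) (trace-digits-≤ τ (input table x y) inputAnnotation)

  key-< : ∀ x y → key x y < (2 + τ) ^ τ
  key-< x y = <-≤-trans (encode-< _ (digits-< x y)) (^-monoʳ-≤ (2 + τ) (trace-length-≤ τ _ _))

  outputs-agree : ∀ {x₁ y₁ x₂ y₂ t₁ t₂ h₁ h₂} → key x₁ y₁ ≡ key x₂ y₂ →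
                  t₁ ≤ τ → run ops N P t₁ (input table x₁ y₁) ≡ halt h₁ →
                  t₂ ≤ τ → run ops N P t₂ (input table x₂ y₂) ≡ halt h₂ →
                  SameSource x₁ y₁ x₂ y₂ (finalTag x₁ y₁) → A h₁ ≡ A h₂
  outputs-agree {x₁} {y₁} {x₂} {y₂} same-key t₁≤τ halts₁ t₂≤τ halts₂ =
    proj₂ (simulation τ (related (refl , id) (refl , id) [] (λ _ → refl) (λ _ → refl))
                       (encode-injective _ _ (digits-< x₁ y₁) (digits-< x₂ y₂) same-key)
                       (trans (final-arun τ _ _) (run-halt-≤ ops N P t₁≤τ halts₁))
                       (trans (final-arun τ _ _) (run-halt-≤ ops N P t₂≤τ halts₂)))
    where
    open Indistinguishable (SameSource x₁ y₁ x₂ y₂) table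
    open Simulation (SameSource x₁ y₁ x₂ y₂) table

module Addition {k cmp} {ops : Fin k → ℕ → ℕ} {M : RAM k cmp} {c τ N : ℕ}
                (computes : ComputesSum ops M c τ N) where
  open InputRun ops N (add M) τ (R (proj₁ computes)) public

  sums-agree : ∀ {x₁ y₁ x₂ y₂} → x₁ < N → y₁ < N → x₂ < N → y₂ < N → key x₁ y₁ ≡ key x₂ y₂ →
               SameSource x₁ y₁ x₂ y₂ (finalTag x₁ y₁) → x₁ + y₁ ≡ x₂ + y₂
  sums-agree {x₁} {y₁} {x₂} {y₂} x₁<N y₁<N x₂<N y₂<N same-key same-source
    with _ , t₁ , t₁≤τ , h₁ , halts₁ , A≡x₁+y₁ ← proj₂ (proj₂ (proj₂ computes)) x₁ y₁ x₁<N y₁<N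
       | _ , t₂ , t₂≤τ , h₂ , halts₂ , A≡x₂+y₂ ← proj₂ (proj₂ (proj₂ computes)) x₂ y₂ x₂<N y₂<N =
    trans (sym A≡x₁+y₁) (trans (outputs-agree same-key t₁≤τ halts₁ t₂≤τ halts₂ same-source) A≡x₂+y₂)

proposition9p1 : (k : ℕ) (ops : Fin k → ℕ → ℕ) (cmp : Bool) →
    ¬ (Σ (RAM k cmp) λ M → ∃ λ c → ∃ λ τ → ∀ N → ComputesSum ops M c τ N)
proposition9p1 k ops cmp (M , c , τ , computes) =
  sum-depends-on-both (finalTag x y) x≢x′ y≢y′
    (sums-agree (row< x<m) (column< y<n) (row< x<m)  (column< y′<n) key-row)
    (sums-agree (row< x<m) (column< y<n) (row< x′<m) (column< y<n)  key-column)
  where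
  K rows N : ℕ
  K    = (2 + τ) ^ τ
  rows = suc (K * suc K)
  N    = rows + suc K
  open Addition {c = c} (computes N)
  open LShape (l-shape K key key-<)
  row< : ∀ {z} → z < rows → z < N
  row< z<rows = ≤-trans z<rows (m≤m+n rows (suc K))
  column< : ∀ {z} → z < suc K → z < N
  column< z<K = ≤-trans z<K (m≤n+m (suc K) rows)
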